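{- A variety $V$ of Heyting algebras is B-saturated if and only if $V$ can be defined within the class of all Heyting algebras by a set of positive formulas, i.e. there is a set $\mathcal{F}$ of positive formulas such that $V$ is exactly the class of Heyting algebras in which all formulas of $\mathcal{F}$ are valid.
   Context: Formulas are built from a countable set of propositional variables using $\land,\lor,\to$ and the constant $\bot$. Positive formulas are those not containing $\bot$. Heyting algebras are Brouwerian algebras $(A,\land,\lor,\to,1)$ (distributive lattice with top and relative pseudo-complementation) with a least element $0$ as a constant. For a Heyting algebra $A$, $A^+$ is its $\{\land,\lor,\to,1\}$-reduct. A Heyting algebra $A$ is B-embedded in a Heyting algebra $C$ if $A^+$ embeds into $C^+$ as a Brouwerian algebra. A variety $V$ of Heyting algebras is B-saturated if every Heyting algebra B-embedded in some member of $V$ belongs to $V$. -}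

module Defs where

open import Level using (Level; _⊔_; suc; 0ℓ)
open import Data.Nat using (ℕ)
open import Data.Product using (Σ; _×_; _,_)
open import Function.Bundles using (_⇔_)
open import Relation.Binary.Lattice.Bundles using (HeytingAlgebra)

data Formula : Set where
  var  : ℕ → Formula
  ⊥f   : Formula
  _∧f_ : Formula → Formula → Formula
  _∨f_ : Formula → Formula → Formula
  _→f_ : Formula → Formula → Formula

data Positive : Formula → Set where
  pos-var : ∀ n → Positive (var n)
  pos-∧   : ∀ {φ ψ} → Positive φ → Positive ψ → Positive (φ ∧f ψ)
  pos-∨   : ∀ {φ ψ} → Positive φ → Positive ψ → Positive (φ ∨f ψ)
  pos-→   : ∀ {φ ψ} → Positive φ → Positive ψ → Positive (φ →f ψ)

module _ {c ℓ₁ ℓ₂ : Level} (A : HeytingAlgebra c ℓ₁ ℓ₂) where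
  open HeytingAlgebra A

  ⟦_⟧ : Formula → (ℕ → Carrier) → Carrier
  ⟦ var n ⟧   v = v n
  ⟦ ⊥f ⟧      v = ⊥
  ⟦ φ ∧f ψ ⟧  v = ⟦ φ ⟧ v ∧ ⟦ ψ ⟧ v
  ⟦ φ ∨f ψ ⟧  v = ⟦ φ ⟧ v ∨ ⟦ ψ ⟧ v
  ⟦ φ →f ψ ⟧  v = ⟦ φ ⟧ v ⇨ ⟦ ψ ⟧ v

  Valid : Formula → Set (c ⊔ ℓ₁)
  Valid φ = ∀ (v : ℕ → Carrier) → ⟦ φ ⟧ v ≈ ⊤

  -- An equation s ≈ t in the language of Heyting algebras
  -- (1 is expressible as ⊥ → ⊥, 0 as ⊥) holds in A.
  Satisfies : Formula × Formula → Set (c ⊔ ℓ₁)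
  Satisfies (s , t) = ∀ (v : ℕ → Carrier) → ⟦ s ⟧ v ≈ ⟦ t ⟧ v

Class : (c ℓ₁ ℓ₂ p : Level) → Set (suc (c ⊔ ℓ₁ ⊔ ℓ₂ ⊔ p))
Class c ℓ₁ ℓ₂ p = HeytingAlgebra c ℓ₁ ℓ₂ → Set p

-- A variety: a class defined by a set of equations (Birkhoff).
IsVariety : ∀ {c ℓ₁ ℓ₂ p} → Class c ℓ₁ ℓ₂ p → Set (suc (c ⊔ ℓ₁ ⊔ ℓ₂) ⊔ p)
IsVariety {c} {ℓ₁} {ℓ₂} V =
  Σ (Formula × Formula → Set) λ E →
    ∀ (A : HeytingAlgebra c ℓ₁ ℓ₂) → V A ⇔ (∀ e → E e → Satisfies A e)

DefinedBy : ∀ {c ℓ₁ ℓ₂ p} → Class c ℓ₁ ℓ₂ p → (Formula → Set) → Set (suc (c ⊔ ℓ₁ ⊔ ℓ₂) ⊔ p)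
DefinedBy {c} {ℓ₁} {ℓ₂} V F =
  ∀ (A : HeytingAlgebra c ℓ₁ ℓ₂) → V A ⇔ (∀ φ → F φ → Valid A φ)

-- A is B-embedded in C: the {∧,∨,→,1}-reduct of A embeds into that of C,
-- i.e. there is an injective map preserving ∧, ∨, → and 1 (not necessarily 0).
record BEmbedding {c ℓ₁ ℓ₂ c' ℓ₁' ℓ₂'}
         (A : HeytingAlgebra c ℓ₁ ℓ₂) (C : HeytingAlgebra c' ℓ₁' ℓ₂')
         : Set (c ⊔ ℓ₁ ⊔ c' ⊔ ℓ₁') where
  private
    module A = HeytingAlgebra A
    module C = HeytingAlgebra C
  field
    f      : A.Carrier → C.Carrier
    cong   : ∀ {x y} → x A.≈ y → f x C.≈ f y
    inj    : ∀ {x y} → f x C.≈ f y → x A.≈ y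
    pres-∧ : ∀ x y → f (x A.∧ y) C.≈ (f x C.∧ f y)
    pres-∨ : ∀ x y → f (x A.∨ y) C.≈ (f x C.∨ f y)
    pres-⇨ : ∀ x y → f (x A.⇨ y) C.≈ (f x C.⇨ f y)
    pres-⊤ : f A.⊤ C.≈ C.⊤

BSaturated : ∀ {c ℓ₁ ℓ₂ p} → Class c ℓ₁ ℓ₂ p → Set (suc (c ⊔ ℓ₁ ⊔ ℓ₂) ⊔ p)
BSaturated {c} {ℓ₁} {ℓ₂} V =
  ∀ (A C : HeytingAlgebra c ℓ₁ ℓ₂) → BEmbedding A C → V C → V A

module Submission where

-- (⇐) Positive formulas only use ∧, ∨, → and variables, so their values
--     are preserved by every B-embedding f : A → C; since f is injective
--     and preserves 1, a positive formula valid in C is valid in A.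
--
-- (⇒) For every a in a Heyting algebra C the principal filter ↑a is a
--     Heyting algebra with bottom a, B-embedded in C by x ↦ x ∨ a; hence a
--     B-saturated V is closed under principal filters.  The positive
--     translation ‹φ› replaces ⊥ by the fresh variable p₀ and every variable
--     pₙ by pₙ₊₁ ∨ p₀; evaluating ‹φ› in C with p₀ := a is evaluating φ in
--     ↑a, and with p₀ := ⊥ it is evaluating φ in C.  So an equation s ≈ t
--     of V becomes the positive formula (‹s› → ‹t›) ∧ (‹t› → ‹s›), valid in
--     C exactly when s ≈ t holds in all principal filters of C; these
--     formulas define V.

open import Defs
open import Level using (Level)
open import Data.Nat using (ℕ; zero; suc)
open import Data.Product using (Σ; _×_; _,_)
open import Function using (_∘_)
open import Function.Bundles using (_⇔_; mk⇔; Equivalence)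
open import Relation.Binary.PropositionalEquality using (_≡_) renaming (refl to ≡-refl)
open import Relation.Binary.Lattice.Bundles using (HeytingAlgebra)
import Relation.Binary.Lattice.Properties.HeytingAlgebra as HeytingProperties
import Relation.Binary.Lattice.Properties.JoinSemilattice as JoinProperties
import Relation.Binary.Lattice.Properties.MeetSemilattice as MeetProperties

module HeytingFacts {c ℓ₁ ℓ₂} (C : HeytingAlgebra c ℓ₁ ℓ₂) where
  open HeytingAlgebra C public
  open HeytingProperties C public using (⇨-cong; y≤x⇨y)
  open JoinProperties joinSemilattice public
    using (∨-cong; ∨-comm; ∨-idempotent; ∨-monotonic; x≤y⇒x∨y≈y)
  open MeetProperties meetSemilattice public using (∧-cong)

  ≈-≤-trans : ∀ {u v w} → u ≈ v → v ≤ w → u ≤ w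
  ≈-≤-trans u≈v v≤w = trans (reflexive u≈v) v≤w

  ≤-≈-trans : ∀ {u v w} → u ≤ v → v ≈ w → u ≤ w
  ≤-≈-trans u≤v v≈w = trans u≤v (reflexive v≈w)

  ∨-absorbs-below : ∀ {a u} → a ≤ u → (u ∨ a) ≈ u
  ∨-absorbs-below {a} {u} a≤u = Eq.trans (∨-comm u a) (x≤y⇒x∨y≈y a≤u)

  ∨-distrib-∨ : ∀ x y a → ((x ∨ y) ∨ a) ≈ ((x ∨ a) ∨ (y ∨ a))
  ∨-distrib-∨ x y a = antisym
    (∨-least (∨-monotonic (x≤x∨y x a) (x≤x∨y y a)) (trans (y≤x∨y x a) (x≤x∨y _ _)))
    (∨-least (∨-monotonic (x≤x∨y x y) refl) (∨-monotonic (y≤x∨y x y) refl))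

  ≈⇒bi-implication≈⊤ : ∀ {x y} → x ≈ y → ((x ⇨ y) ∧ (y ⇨ x)) ≈ ⊤
  ≈⇒bi-implication≈⊤ x≈y = antisym (maximum _)
    (∧-greatest (transpose-⇨ (trans (x∧y≤y _ _) (reflexive x≈y)))
                (transpose-⇨ (trans (x∧y≤y _ _) (reflexive (Eq.sym x≈y)))))

  bi-implication≈⊤⇒≈ : ∀ {x y} → ((x ⇨ y) ∧ (y ⇨ x)) ≈ ⊤ → x ≈ y
  bi-implication≈⊤⇒≈ {x} {y} bi≈⊤ = antisym
    (trans (∧-greatest (maximum x) refl)
      (transpose-∧ (trans (reflexive (Eq.sym bi≈⊤)) (x∧y≤x _ _))))
    (trans (∧-greatest (maximum y) refl)
      (transpose-∧ (trans (reflexive (Eq.sym bi≈⊤)) (x∧y≤y _ _))))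

-- The principal filter ↑a = {x | a ≤ x} of C, represented on the carrier
-- of C via the retraction x ↦ x ∨ a: two elements are identified when
-- their images agree.
module PrincipalFilter {c ℓ₁ ℓ₂} (C : HeytingAlgebra c ℓ₁ ℓ₂) (a : HeytingAlgebra.Carrier C) where
  open HeytingFacts C

  into : Carrier → Carrier
  into x = x ∨ a

  into-∨ : ∀ x y → into (x ∨ y) ≈ (into x ∨ into y)
  into-∨ x y = ∨-distrib-∨ x y a

  _∧↑_ _⇨↑_ : Carrier → Carrier → Carrier
  x ∧↑ y = into x ∧ into y
  x ⇨↑ y = into x ⇨ into y

  into-∧ : ∀ x y → into (x ∧↑ y) ≈ (into x ∧ into y)
  into-∧ x y = ∨-absorbs-below (∧-greatest (y≤x∨y _ _) (y≤x∨y _ _))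

  into-⇨ : ∀ x y → into (x ⇨↑ y) ≈ (into x ⇨ into y)
  into-⇨ x y = ∨-absorbs-below (trans (y≤x∨y y a) y≤x⇨y)

  into-⊤ : into ⊤ ≈ ⊤
  into-⊤ = ∨-absorbs-below (maximum a)

  into-a : into a ≈ a
  into-a = ∨-idempotent a

  ↑ : HeytingAlgebra c ℓ₁ ℓ₂
  ↑ = record
    { Carrier = Carrier
    ; _≈_ = λ x y → into x ≈ into y
    ; _≤_ = λ x y → into x ≤ into y
    ; _∨_ = _∨_
    ; _∧_ = _∧↑_
    ; _⇨_ = _⇨↑_
    ; ⊤ = ⊤
    ; ⊥ = a
    ; isHeytingAlgebra = record
      { isBoundedLattice = record
        { isLattice = record
          { isPartialOrder = record
            { isPreorder = record
              { isEquivalence = record { refl = Eq.refl ; sym = Eq.sym ; trans = Eq.trans }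
              ; reflexive = reflexive
              ; trans = trans }
            ; antisym = antisym }
          ; supremum = λ x y →
              ≤-≈-trans (x≤x∨y (into x) (into y)) (Eq.sym (into-∨ x y))
            , ≤-≈-trans (y≤x∨y (into x) (into y)) (Eq.sym (into-∨ x y))
            , λ z x≤z y≤z → ≈-≤-trans (into-∨ x y) (∨-least x≤z y≤z)
          ; infimum = λ x y →
              ≈-≤-trans (into-∧ x y) (x∧y≤x _ _)
            , ≈-≤-trans (into-∧ x y) (x∧y≤y _ _)
            , λ z z≤x z≤y → ≤-≈-trans (∧-greatest z≤x z≤y) (Eq.sym (into-∧ x y)) }
        ; maximum = λ x → ≤-≈-trans (maximum _) (Eq.sym into-⊤)
        ; minimum = λ x → ≈-≤-trans into-a (y≤x∨y x a) }
      ; exponential = λ w x y →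
          (λ w∧x≤y → ≤-≈-trans (transpose-⇨ (≈-≤-trans (Eq.sym (into-∧ w x)) w∧x≤y))
                                (Eq.sym (into-⇨ x y)))
        , (λ w≤x⇨y → ≈-≤-trans (into-∧ w x) (transpose-∧ (≤-≈-trans w≤x⇨y (into-⇨ x y)))) } }

  -- ↑a is B-embedded in C (the embedding need not send the bottom a to ⊥).
  ↑-embedding : BEmbedding ↑ C
  ↑-embedding = record
    { f = into ; cong = λ e → e ; inj = λ e → e
    ; pres-∧ = into-∧ ; pres-∨ = into-∨ ; pres-⇨ = into-⇨ ; pres-⊤ = into-⊤ }

open PrincipalFilter using (↑; ↑-embedding)

module _ {c ℓ₁ ℓ₂ c' ℓ₁' ℓ₂'} {A : HeytingAlgebra c ℓ₁ ℓ₂} {C : HeytingAlgebra c' ℓ₁' ℓ₂'}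
         (e : BEmbedding A C) where
  open BEmbedding e
  private
    module A = HeytingFacts A
    module C = HeytingFacts C

  embedding-commutes : ∀ (v : ℕ → A.Carrier) {φ} → Positive φ →
    f (⟦_⟧ A φ v) C.≈ ⟦_⟧ C φ (f ∘ v)
  embedding-commutes v (pos-var n) = C.Eq.refl
  embedding-commutes v (pos-∧ p q) =
    C.Eq.trans (pres-∧ _ _) (C.∧-cong (embedding-commutes v p) (embedding-commutes v q))
  embedding-commutes v (pos-∨ p q) =
    C.Eq.trans (pres-∨ _ _) (C.∨-cong (embedding-commutes v p) (embedding-commutes v q))
  embedding-commutes v (pos-→ p q) =
    C.Eq.trans (pres-⇨ _ _) (C.⇨-cong (embedding-commutes v p) (embedding-commutes v q))

  positive-valid-reflected : ∀ {φ} → Positive φ → Valid C φ → Valid A φ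
  positive-valid-reflected φ⁺ valid v =
    inj (C.Eq.trans (embedding-commutes v φ⁺) (C.Eq.trans (valid (f ∘ v)) (C.Eq.sym pres-⊤)))

positively-defined⇒saturated : ∀ {c ℓ₁ ℓ₂ p} (V : Class c ℓ₁ ℓ₂ p) (F : Formula → Set) →
  (∀ φ → F φ → Positive φ) → DefinedBy V F → BSaturated V
positively-defined⇒saturated V F F⁺ defines A C e VC = Equivalence.from (defines A)
  λ φ Fφ → positive-valid-reflected e (F⁺ φ Fφ) (Equivalence.to (defines C) VC φ Fφ)

saturated⇒filter-closed : ∀ {c ℓ₁ ℓ₂ p} (V : Class c ℓ₁ ℓ₂ p) → BSaturated V →
  ∀ C a → V C → V (↑ C a)
saturated⇒filter-closed V saturated C a = saturated (↑ C a) C (↑-embedding C a)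

_∷_ : ∀ {a} {X : Set a} → X → (ℕ → X) → ℕ → X
(x ∷ v) zero    = x
(x ∷ v) (suc n) = v n

‹_› : Formula → Formula
‹ var n ›  = var (suc n) ∨f var 0
‹ ⊥f ›     = var 0
‹ φ ∧f ψ › = ‹ φ › ∧f ‹ ψ ›
‹ φ ∨f ψ › = ‹ φ › ∨f ‹ ψ ›
‹ φ →f ψ › = ‹ φ › →f ‹ ψ ›

‹›-positive : ∀ φ → Positive ‹ φ ›
‹›-positive (var n)  = pos-∨ (pos-var (suc n)) (pos-var 0)
‹›-positive ⊥f       = pos-var 0
‹›-positive (φ ∧f ψ) = pos-∧ (‹›-positive φ) (‹›-positive ψ)
‹›-positive (φ ∨f ψ) = pos-∨ (‹›-positive φ) (‹›-positive ψ)
‹›-positive (φ →f ψ) = pos-→ (‹›-positive φ) (‹›-positive ψ)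

equationFormula : Formula × Formula → Formula
equationFormula (s , t) = (‹ s › →f ‹ t ›) ∧f (‹ t › →f ‹ s ›)

equationFormula-positive : ∀ e → Positive (equationFormula e)
equationFormula-positive (s , t) =
  pos-∧ (pos-→ (‹›-positive s) (‹›-positive t)) (pos-→ (‹›-positive t) (‹›-positive s))

module _ {c ℓ₁ ℓ₂} (C : HeytingAlgebra c ℓ₁ ℓ₂) where
  open HeytingFacts C

  ‹›-evaluates-in-filter : ∀ (u : ℕ → Carrier) φ →
    PrincipalFilter.into C (u 0) (⟦_⟧ (↑ C (u 0)) φ (u ∘ suc)) ≈ ⟦_⟧ C ‹ φ › u
  ‹›-evaluates-in-filter u (var n)  = Eq.refl
  ‹›-evaluates-in-filter u ⊥f       = PrincipalFilter.into-a C (u 0)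
  ‹›-evaluates-in-filter u (φ ∧f ψ) = Eq.trans (PrincipalFilter.into-∧ C (u 0) _ _)
    (∧-cong (‹›-evaluates-in-filter u φ) (‹›-evaluates-in-filter u ψ))
  ‹›-evaluates-in-filter u (φ ∨f ψ) = Eq.trans (PrincipalFilter.into-∨ C (u 0) _ _)
    (∨-cong (‹›-evaluates-in-filter u φ) (‹›-evaluates-in-filter u ψ))
  ‹›-evaluates-in-filter u (φ →f ψ) = Eq.trans (PrincipalFilter.into-⇨ C (u 0) _ _)
    (⇨-cong (‹›-evaluates-in-filter u φ) (‹›-evaluates-in-filter u ψ))

  ‹›-evaluates-at-⊥ : ∀ (v : ℕ → Carrier) φ → ⟦_⟧ C ‹ φ › (⊥ ∷ v) ≈ ⟦_⟧ C φ v
  ‹›-evaluates-at-⊥ v (var n)  = ∨-absorbs-below (minimum _)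
  ‹›-evaluates-at-⊥ v ⊥f       = Eq.refl
  ‹›-evaluates-at-⊥ v (φ ∧f ψ) = ∧-cong (‹›-evaluates-at-⊥ v φ) (‹›-evaluates-at-⊥ v ψ)
  ‹›-evaluates-at-⊥ v (φ ∨f ψ) = ∨-cong (‹›-evaluates-at-⊥ v φ) (‹›-evaluates-at-⊥ v ψ)
  ‹›-evaluates-at-⊥ v (φ →f ψ) = ⇨-cong (‹›-evaluates-at-⊥ v φ) (‹›-evaluates-at-⊥ v ψ)

  filters-satisfy⇒equationFormula-valid : ∀ e → (∀ a → Satisfies (↑ C a) e) →
    Valid C (equationFormula e)
  filters-satisfy⇒equationFormula-valid (s , t) satisfied u = ≈⇒bi-implication≈⊤
    (Eq.trans (Eq.sym (‹›-evaluates-in-filter u s))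
      (Eq.trans (satisfied (u 0) (u ∘ suc)) (‹›-evaluates-in-filter u t)))

  equationFormula-valid⇒satisfies : ∀ e → Valid C (equationFormula e) → Satisfies C e
  equationFormula-valid⇒satisfies (s , t) valid v =
    Eq.trans (Eq.sym (‹›-evaluates-at-⊥ v s))
      (Eq.trans (bi-implication≈⊤⇒≈ (valid (⊥ ∷ v))) (‹›-evaluates-at-⊥ v t))

saturated⇒positively-defined : ∀ {c ℓ₁ ℓ₂ p} (V : Class c ℓ₁ ℓ₂ p) → IsVariety V →
  BSaturated V → Σ (Formula → Set) (λ F → (∀ φ → F φ → Positive φ) × DefinedBy V F)
saturated⇒positively-defined V (E , axiomatises) saturated = F , F-positive , F-defines
  where
  F : Formula → Set
  F φ = Σ (Formula × Formula) λ e → E e × (φ ≡ equationFormula e)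

  F-positive : ∀ φ → F φ → Positive φ
  F-positive _ (e , _ , ≡-refl) = equationFormula-positive e

  F-defines : DefinedBy V F
  F-defines C = mk⇔
    (λ VC → λ { _ (e , Ee , ≡-refl) → filters-satisfy⇒equationFormula-valid C e λ a →
      Equivalence.to (axiomatises (↑ C a)) (saturated⇒filter-closed V saturated C a VC) e Ee })
    (λ valid → Equivalence.from (axiomatises C) λ e Ee →
      equationFormula-valid⇒satisfies C e (valid (equationFormula e) (e , Ee , ≡-refl)))

mainTheorem14 : ∀ {c ℓ₁ ℓ₂ p : Level} (V : Class c ℓ₁ ℓ₂ p) → IsVariety V →
    BSaturated V ⇔ Σ (Formula → Set) (λ F → (∀ φ → F φ → Positive φ) × DefinedBy V F)
mainTheorem14 V isVariety = mk⇔
  (saturated⇒positively-defined V isVariety)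
  (λ { (F , F-positive , defines) → positively-defined⇒saturated V F F-positive defines })
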